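{- Let $P$ be a pattern and let $P'$ be the pattern obtained from $P$ by deleting a good line of $P$. If $P'$ is not TP-completable, then $P$ is not TP-completable.
   Context: A pattern is a rectangular array of positions each marked "specified" or "unspecified"; a line is a row or a column. A partial matrix with a pattern assigns real numbers to the specified positions; it is partial TP if every square submatrix (arbitrary, not necessarily contiguous, rows and columns) consisting only of specified entries has positive determinant. A pattern is TP-completable if every partial TP matrix with that pattern can be completed (unspecified entries filled with reals) to a totally positive matrix. A subset $U$ of the unspecified positions of a pattern is completable if for every partial TP matrix with that pattern, real values can be assigned to the positions of $U$ so that the resulting partial matrix is still partial TP. A row $r$ of a pattern $P$ is a good row if, in the pattern obtained from $P$ by keeping all rows but only the columns in which row $r$ has a specified entry, and then declaring those entries of row $r$ unspecified, the set of (now all unspecified) positions of row $r$ is a completable subset. Good columns are defined analogously with rows and columns interchanged; a good line is a good row or a good column. -}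

module Defs where

open import Data.Nat using (ℕ; zero; suc)
open import Data.Fin using (Fin; zero; suc; punchIn; toℕ) renaming (_<_ to _<ᶠ_)
open import Data.Bool using (Bool; true; false; _∨_)
open import Data.Fin using (_≟_)
open import Data.Product using (Σ; ∃; _×_; _,_)
open import Data.Sum using (_⊎_)
open import Relation.Nullary using (¬_; yes; no)
open import Relation.Binary.PropositionalEquality using (_≡_)
open import Algebra.Structures using (IsCommutativeRing)
open import Relation.Binary.Structures using (IsStrictTotalOrder)

-- The real numbers, given axiomatically as a complete ordered field
-- (unique up to isomorphism), since agda-stdlib has no reals.

record CompleteOrderedField : Set₁ where
  infixl 6 _+_
  infixl 7 _*_
  infix 4 _<_ _≤_
  field
    R         : Set
    0# 1#     : R
    _+_ _*_   : R → R → R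
    -_        : R → R
    _<_       : R → R → Set
    isCommutativeRing : IsCommutativeRing _≡_ _+_ _*_ -_ 0# 1#
    0≢1       : ¬ (0# ≡ 1#)
    inverse   : ∀ x → ¬ (x ≡ 0#) → Σ R λ y → x * y ≡ 1#
    isStrictTotalOrder : IsStrictTotalOrder _≡_ _<_
    +-mono-<  : ∀ x y z → x < y → x + z < y + z
    *-pos     : ∀ x y → 0# < x → 0# < y → 0# < x * y

  _≤_ : R → R → Set
  x ≤ y = x < y ⊎ x ≡ y

  field
    sup : (S : R → Set) → Σ R S → Σ R (λ b → ∀ x → S x → x ≤ b) →
          Σ R λ s → (∀ x → S x → x ≤ s) × (∀ b → (∀ x → S x → x ≤ b) → s ≤ b)

-- Patterns: true = specified, false = unspecified.

Pattern : ℕ → ℕ → Set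
Pattern m n = Fin m → Fin n → Bool

transpose : ∀ {m n} → Pattern m n → Pattern n m
transpose P j i = P i j

deleteRow : ∀ {m n} → Pattern (suc m) n → Fin (suc m) → Pattern m n
deleteRow P r i j = P (punchIn r i) j

deleteColumn : ∀ {m n} → Pattern m (suc n) → Fin (suc n) → Pattern m n
deleteColumn P c i j = P i (punchIn c j)

StrictlyIncreasing : ∀ {k m} → (Fin k → Fin m) → Set
StrictlyIncreasing {k} f = ∀ (i j : Fin k) → i <ᶠ j → f i <ᶠ f j

module OverField (F : CompleteOrderedField) where
  open CompleteOrderedField F

  Matrix : ℕ → ℕ → Set
  Matrix m n = Fin m → Fin n → R

  sumFin : ∀ k → (Fin k → R) → R
  sumFin zero    f = 0#
  sumFin (suc k) f = f zero + sumFin k (λ i → f (suc i))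

  alt : ℕ → R → R
  alt zero    x = x
  alt (suc j) x = - alt j x

  det : ∀ k → Matrix k k → R
  det zero    M = 1#
  det (suc k) M = sumFin (suc k) λ j →
    alt (toℕ j) (M zero j * det k (λ i l → M (suc i) (punchIn j l)))

  sub : ∀ {m n k} → Matrix m n → (Fin k → Fin m) → (Fin k → Fin n) → Matrix k k
  sub A f g i j = A (f i) (g j)

  -- A partial matrix with pattern P is a full array whose entries at
  -- unspecified positions are ignored.
  PartialTP : ∀ {m n} → Pattern m n → Matrix m n → Set
  PartialTP {m} {n} P A =
    ∀ k (f : Fin k → Fin m) (g : Fin k → Fin n) →
    StrictlyIncreasing f → StrictlyIncreasing g →
    (∀ i j → P (f i) (g j) ≡ true) →
    0# < det k (sub A f g)

  TotallyPositive : ∀ {m n} → Matrix m n → Set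
  TotallyPositive {m} {n} B =
    ∀ k (f : Fin k → Fin m) (g : Fin k → Fin n) →
    StrictlyIncreasing f → StrictlyIncreasing g →
    0# < det k (sub B f g)

  AgreesOn : ∀ {m n} → Pattern m n → Matrix m n → Matrix m n → Set
  AgreesOn P A B = ∀ i j → P i j ≡ true → B i j ≡ A i j

  TPCompletable : ∀ {m n} → Pattern m n → Set
  TPCompletable {m} {n} P =
    ∀ (A : Matrix m n) → PartialTP P A →
    Σ (Matrix m n) λ B → AgreesOn P A B × TotallyPositive B

  CompletableSubset : ∀ {m n} → Pattern m n → Pattern m n → Set
  CompletableSubset {m} {n} P U =
    (∀ i j → U i j ≡ true → P i j ≡ false) ×
    (∀ (A : Matrix m n) → PartialTP P A →
       Σ (Matrix m n) λ B → AgreesOn P A B × PartialTP (λ i j → P i j ∨ U i j) B)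

  isRow : ∀ {m} → Fin m → Fin m → Bool
  isRow r i with i ≟ r
  ... | yes _ = true
  ... | no  _ = false

  -- c : Fin k → Fin n enumerates (in increasing order) exactly the columns
  -- in which row r of P is specified; the restricted pattern keeps these
  -- columns and makes row r unspecified.
  GoodRow : ∀ {m n} → Pattern m n → Fin m → Set
  GoodRow {m} {n} P r =
    ∀ k (c : Fin k → Fin n) → StrictlyIncreasing c →
    (∀ l → P r (c l) ≡ true) →
    (∀ j → P r j ≡ true → ∃ λ l → c l ≡ j) →
    CompletableSubset
      (λ i l → if isRow r i then false else P i (c l))
      (λ i l → isRow r i)
    where open import Data.Bool using (if_then_else_)

  GoodColumn : ∀ {m n} → Pattern m n → Fin n → Set
  GoodColumn P c = GoodRow (transpose P) c

  data DeleteGoodLine : ∀ {m n m' n'} → Pattern m n → Pattern m' n' → Set where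
    row    : ∀ {m n} (P : Pattern (suc m) n) (r : Fin (suc m)) →
             GoodRow P r → DeleteGoodLine P (deleteRow P r)
    column : ∀ {m n} (P : Pattern m (suc n)) (c : Fin (suc n)) →
             GoodColumn P c → DeleteGoodLine P (deleteColumn P c)

-- A good row r of P can be filled in: a partial TP matrix for the pattern
-- without row r, restricted to the columns where row r is specified, gets
-- row r completed by goodness, and reading those values back into row r
-- yields a partial TP matrix for P. Hence a TP completion for P restricts
-- to one for the pattern without row r. Columns reduce to rows because
-- transposition preserves determinants.
module Submission where

open import Defs
open import Data.Nat using (ℕ; zero; suc; s≤s; z≤n)
open import Data.Nat.Properties using (≰⇒>; <⇒≱)
open import Data.Fin using (Fin; zero; suc; punchIn; punchOut; toℕ; _≟_)
  renaming (_<_ to _<ᶠ_)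
open import Data.Fin.Properties
  using (<-cmp; <-irrefl; <-asym; punchInᵢ≢i; punchIn-mono-≤; punchIn-cancel-≤;
         punchOut-cong; punchOut-punchIn; punchIn-punchOut; any?)
open import Data.Bool using (Bool; true; false; _∨_; if_then_else_)
open import Data.Bool.Properties using (∨-identityʳ)
open import Data.Product using (Σ; ∃; _×_; _,_; proj₁; proj₂)
import Data.Product as Σ
open import Relation.Nullary using (¬_; yes; no; contradiction)
open import Relation.Binary.Definitions using (tri<; tri≈; tri>)
open import Relation.Binary.PropositionalEquality
  using (_≡_; _≢_; refl; sym; trans; cong; cong₂; subst; subst₂; module ≡-Reasoning)
open import Function using (_∘_)
open import Algebra.Bundles using (CommutativeRing)

StrictlyIncreasing⇒injective : ∀ {k n} {c : Fin k → Fin n} → StrictlyIncreasing c →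
                               ∀ {a b} → c a ≡ c b → a ≡ b
StrictlyIncreasing⇒injective {c = c} c↑ {a} {b} ca≡cb with <-cmp a b
... | tri< a<b _ _ = contradiction (c↑ a b a<b) (<-irrefl ca≡cb)
... | tri≈ _ a≡b _ = a≡b
... | tri> _ _ b<a = contradiction (c↑ b a b<a) (<-irrefl (sym ca≡cb))

StrictlyIncreasing⇒cancel-< : ∀ {k n} {c : Fin k → Fin n} → StrictlyIncreasing c →
                              ∀ {a b} → c a <ᶠ c b → a <ᶠ b
StrictlyIncreasing⇒cancel-< {c = c} c↑ {a} {b} ca<cb with <-cmp a b
... | tri< a<b _ _ = a<b
... | tri≈ _ refl _ = contradiction ca<cb (<-irrefl refl)
... | tri> _ _ b<a = contradiction (c↑ b a b<a) (<-asym ca<cb)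

punchIn-mono-< : ∀ {m} (r : Fin (suc m)) {x y : Fin m} → x <ᶠ y → punchIn r x <ᶠ punchIn r y
punchIn-mono-< r {x} {y} x<y = ≰⇒> (λ ry≤rx → <⇒≱ x<y (punchIn-cancel-≤ r y x ry≤rx))

punchIn-cancel-< : ∀ {m} (r : Fin (suc m)) {x y : Fin m} → punchIn r x <ᶠ punchIn r y → x <ᶠ y
punchIn-cancel-< r {x} {y} rx<ry = ≰⇒> (λ y≤x → <⇒≱ rx<ry (punchIn-mono-≤ r y x y≤x))

punchOut-strictlyIncreasing : ∀ {k m} {r : Fin (suc m)} {f : Fin k → Fin (suc m)} →
  (r≢f : ∀ a → r ≢ f a) → StrictlyIncreasing f → StrictlyIncreasing (λ a → punchOut (r≢f a))
punchOut-strictlyIncreasing {r = r} r≢f f↑ a b a<b = punchIn-cancel-< r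
  (subst₂ _<ᶠ_ (sym (punchIn-punchOut (r≢f a))) (sym (punchIn-punchOut (r≢f b))) (f↑ a b a<b))

record Enumeration {n} (p : Fin n → Bool) : Set where
  field
    size       : ℕ
    index      : Fin size → Fin n
    increasing : StrictlyIncreasing index
    sound      : ∀ l → p (index l) ≡ true
    complete   : ∀ j → p j ≡ true → ∃ λ l → index l ≡ j

module _ {n} {p : Fin (suc n) → Bool} (E : Enumeration (p ∘ suc)) where
  open Enumeration E

  skipZero : p zero ≡ false → Enumeration p
  skipZero p0≡false = record
    { size       = size
    ; index      = suc ∘ index
    ; increasing = λ a b → s≤s ∘ increasing a b
    ; sound      = sound
    ; complete   = λ { zero p0≡true → contradiction (trans (sym p0≡false) p0≡true) λ ()
                     ; (suc j) pj → Σ.map₂ (cong suc) (complete j pj) } }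

  keepZero : p zero ≡ true → Enumeration p
  keepZero p0≡true = record
    { size = suc size ; index = index′ ; increasing = increasing′
    ; sound = sound′ ; complete = complete′ }
    where
    index′ : Fin (suc size) → Fin (suc n)
    index′ zero    = zero
    index′ (suc l) = suc (index l)

    increasing′ : StrictlyIncreasing index′
    increasing′ zero    (suc b) _         = s≤s z≤n
    increasing′ (suc a) (suc b) (s≤s a<b) = s≤s (increasing a b a<b)

    sound′ : ∀ l → p (index′ l) ≡ true
    sound′ zero    = p0≡true
    sound′ (suc l) = sound l

    complete′ : ∀ j → p j ≡ true → ∃ λ l → index′ l ≡ j
    complete′ zero    _  = zero , refl
    complete′ (suc j) pj = Σ.map suc (cong suc) (complete j pj)

enumerate : ∀ {n} (p : Fin n → Bool) → Enumeration p
enumerate {zero}  p = record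
  { size = 0 ; index = λ () ; increasing = λ () ; sound = λ () ; complete = λ () }
enumerate {suc n} p with p zero in p0
... | true  = keepZero (enumerate (p ∘ suc)) p0
... | false = skipZero (enumerate (p ∘ suc)) p0

module _ (F : CompleteOrderedField) where
  open CompleteOrderedField F
  open OverField F

  commutativeRing : CommutativeRing _ _
  commutativeRing = record
    { Carrier = R ; _≈_ = _≡_ ; _+_ = _+_ ; _*_ = _*_ ; -_ = -_ ; 0# = 0# ; 1# = 1#
    ; isCommutativeRing = isCommutativeRing }

  open CommutativeRing commutativeRing
    using (ring; +-commutativeSemigroup; *-commutativeSemigroup; +-identityʳ; zeroʳ; distribˡ)
  open import Algebra.Properties.Ring ring using (-1*x≈-x; -‿distribʳ-*)
  open import Algebra.Properties.CommutativeSemigroup +-commutativeSemigroup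
    using () renaming (interchange to +-interchange)
  open import Algebra.Properties.CommutativeSemigroup *-commutativeSemigroup
    using () renaming (x∙yz≈y∙xz to *-x∙yz≈y∙xz)
  open ≡-Reasoning

  sumFin-cong : ∀ k {f g : Fin k → R} → (∀ i → f i ≡ g i) → sumFin k f ≡ sumFin k g
  sumFin-cong zero    f≗g = refl
  sumFin-cong (suc k) f≗g = cong₂ _+_ (f≗g zero) (sumFin-cong k (f≗g ∘ suc))

  sumFin-zero : ∀ k → sumFin k (λ _ → 0#) ≡ 0#
  sumFin-zero zero    = refl
  sumFin-zero (suc k) = trans (cong (0# +_) (sumFin-zero k)) (+-identityʳ 0#)

  sumFin-distrib-+ : ∀ k (f g : Fin k → R) →
                     sumFin k (λ i → f i + g i) ≡ sumFin k f + sumFin k g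
  sumFin-distrib-+ zero    f g = sym (+-identityʳ 0#)
  sumFin-distrib-+ (suc k) f g = begin
    (f zero + g zero) + sumFin k (λ i → f (suc i) + g (suc i))
      ≡⟨ cong (f zero + g zero +_) (sumFin-distrib-+ k (f ∘ suc) (g ∘ suc)) ⟩
    (f zero + g zero) + (sumFin k (f ∘ suc) + sumFin k (g ∘ suc))
      ≡⟨ +-interchange (f zero) (g zero) _ _ ⟩
    (f zero + sumFin k (f ∘ suc)) + (g zero + sumFin k (g ∘ suc))   ∎

  sumFin-comm : ∀ k l (f : Fin k → Fin l → R) →
    sumFin k (λ i → sumFin l (f i)) ≡ sumFin l (λ j → sumFin k (λ i → f i j))
  sumFin-comm zero    l f = sym (sumFin-zero l)
  sumFin-comm (suc k) l f = trans (cong (sumFin l (f zero) +_) (sumFin-comm k l (f ∘ suc)))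
                                  (sym (sumFin-distrib-+ l (f zero) _))

  *-distribˡ-sumFin : ∀ k x (f : Fin k → R) → x * sumFin k f ≡ sumFin k (λ i → x * f i)
  *-distribˡ-sumFin zero    x f = zeroʳ x
  *-distribˡ-sumFin (suc k) x f =
    trans (distribˡ x (f zero) _) (cong (x * f zero +_) (*-distribˡ-sumFin k x (f ∘ suc)))

  -‿distrib-sumFin : ∀ k (f : Fin k → R) → - sumFin k f ≡ sumFin k (λ i → - f i)
  -‿distrib-sumFin k f = begin
    - sumFin k f                  ≡⟨ -1*x≈-x _ ⟨
    - 1# * sumFin k f             ≡⟨ *-distribˡ-sumFin k (- 1#) f ⟩
    sumFin k (λ i → - 1# * f i)   ≡⟨ sumFin-cong k (-1*x≈-x ∘ f) ⟩
    sumFin k (λ i → - f i)        ∎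

  alt-sumFin : ∀ n k (f : Fin k → R) → alt n (sumFin k f) ≡ sumFin k (alt n ∘ f)
  alt-sumFin zero    k f = refl
  alt-sumFin (suc n) k f = trans (cong -_ (alt-sumFin n k f)) (-‿distrib-sumFin k _)

  *-alt : ∀ n x y → x * alt n y ≡ alt n (x * y)
  *-alt zero    x y = refl
  *-alt (suc n) x y = trans (sym (-‿distribʳ-* x _)) (cong -_ (*-alt n x y))

  alt-neg : ∀ n x → alt n (- x) ≡ - alt n x
  alt-neg zero    x = refl
  alt-neg (suc n) x = cong -_ (alt-neg n x)

  alt-comm : ∀ m n x → alt m (alt n x) ≡ alt n (alt m x)
  alt-comm zero    n x = refl
  alt-comm (suc m) n x = trans (cong -_ (alt-comm m n x)) (sym (alt-neg n _))

  alt-*-sumFin : ∀ n k x (e : Fin k → ℕ) (f : Fin k → R) →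
    alt n (x * sumFin k (λ i → alt (e i) (f i))) ≡ sumFin k (λ i → alt n (alt (e i) (x * f i)))
  alt-*-sumFin n k x e f = begin
    alt n (x * sumFin k (λ i → alt (e i) (f i)))
      ≡⟨ cong (alt n) (*-distribˡ-sumFin k x _) ⟩
    alt n (sumFin k (λ i → x * alt (e i) (f i)))
      ≡⟨ cong (alt n) (sumFin-cong k λ i → *-alt (e i) x (f i)) ⟩
    alt n (sumFin k (λ i → alt (e i) (x * f i)))
      ≡⟨ alt-sumFin n k _ ⟩
    sumFin k (λ i → alt n (alt (e i) (x * f i)))   ∎

  -- Both sides are the double sum of (-1)^(i+j+1) x_j y_i D_ij.
  alternating-exchange : ∀ k (x y : Fin k → R) (D : Fin k → Fin k → R) →
    sumFin k (λ j → alt (suc (toℕ j)) (x j * sumFin k (λ i → alt (toℕ i) (y i * D i j)))) ≡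
    sumFin k (λ i → alt (suc (toℕ i)) (y i * sumFin k (λ j → alt (toℕ j) (x j * D i j))))
  alternating-exchange k x y D = begin
    sumFin k (λ j → alt (suc (toℕ j)) (x j * sumFin k (λ i → alt (toℕ i) (y i * D i j))))
      ≡⟨ sumFin-cong k (λ j → alt-*-sumFin (suc (toℕ j)) k (x j) toℕ (λ i → y i * D i j)) ⟩
    sumFin k (λ j → sumFin k (λ i → alt (suc (toℕ j)) (alt (toℕ i) (x j * (y i * D i j)))))
      ≡⟨ sumFin-comm k k _ ⟩
    sumFin k (λ i → sumFin k (λ j → alt (suc (toℕ j)) (alt (toℕ i) (x j * (y i * D i j)))))
      ≡⟨ sumFin-cong k (λ i → sumFin-cong k λ j → exchange (toℕ j) (toℕ i) (x j) (y i) (D i j)) ⟩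
    sumFin k (λ i → sumFin k (λ j → alt (suc (toℕ i)) (alt (toℕ j) (y i * (x j * D i j)))))
      ≡⟨ sumFin-cong k (λ i → alt-*-sumFin (suc (toℕ i)) k (y i) toℕ (λ j → x j * D i j)) ⟨
    sumFin k (λ i → alt (suc (toℕ i)) (y i * sumFin k (λ j → alt (toℕ j) (x j * D i j))))   ∎
    where
    exchange : ∀ m n a b d → alt (suc m) (alt n (a * (b * d))) ≡ alt (suc n) (alt m (b * (a * d)))
    exchange m n a b d = cong -_ (trans (alt-comm m n _) (cong (alt n ∘ alt m) (*-x∙yz≈y∙xz a b d)))

  minor : ∀ {k} → Matrix (suc k) (suc k) → Fin (suc k) → Fin (suc k) → Matrix k k
  minor M i j a b = M (punchIn i a) (punchIn j b)

  det-expandFirstColumn : ∀ k (M : Matrix (suc k) (suc k)) →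
    det (suc k) M ≡ sumFin (suc k) (λ i → alt (toℕ i) (M i zero * det k (minor M i zero)))
  det-expandFirstColumn zero    M = refl
  det-expandFirstColumn (suc k) M = cong (M zero zero * det (suc k) (minor M zero zero) +_) (begin
    sumFin (suc k) (λ j → alt (suc (toℕ j)) (M zero (suc j) * det (suc k) (minor M zero (suc j))))
      ≡⟨ sumFin-cong (suc k) (λ j → cong (λ d → alt (suc (toℕ j)) (M zero (suc j) * d))
                                         (det-expandFirstColumn k (minor M zero (suc j)))) ⟩
    sumFin (suc k) (λ j → alt (suc (toℕ j)) (M zero (suc j) *
      sumFin (suc k) (λ i → alt (toℕ i) (M (suc i) zero * det k (minor (minor M zero zero) i j)))))
      ≡⟨ alternating-exchange (suc k) (λ j → M zero (suc j)) (λ i → M (suc i) zero)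
                              (λ i j → det k (minor (minor M zero zero) i j)) ⟩
    sumFin (suc k) (λ i → alt (suc (toℕ i)) (M (suc i) zero * det (suc k) (minor M (suc i) zero)))
      ∎)

  det-cong : ∀ k {M N : Matrix k k} → (∀ i j → M i j ≡ N i j) → det k M ≡ det k N
  det-cong zero    M≗N = refl
  det-cong (suc k) M≗N = sumFin-cong (suc k) λ j →
    cong₂ (λ x d → alt (toℕ j) (x * d)) (M≗N zero j)
          (det-cong k λ a b → M≗N (suc a) (punchIn j b))

  _ᵀ : ∀ {m n} → Matrix m n → Matrix n m
  (M ᵀ) i j = M j i

  det-transpose : ∀ k (M : Matrix k k) → det k (M ᵀ) ≡ det k M
  det-transpose zero    M = refl
  det-transpose (suc k) M = trans
    (sumFin-cong (suc k) λ i →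
      cong (λ d → alt (toℕ i) (M i zero * d)) (det-transpose k (minor M i zero)))
    (sym (det-expandFirstColumn k M))

  PartialTP-transpose : ∀ {m n} {P : Pattern m n} {A : Matrix m n} →
                        PartialTP P A → PartialTP (transpose P) (A ᵀ)
  PartialTP-transpose {A = A} A-pTP k f g f↑ g↑ spec =
    subst (0# <_) (sym (det-transpose k (sub A g f))) (A-pTP k g f g↑ f↑ λ i j → spec j i)

  TotallyPositive-transpose : ∀ {m n} {B : Matrix m n} → TotallyPositive B → TotallyPositive (B ᵀ)
  TotallyPositive-transpose {B = B} B-TP k f g f↑ g↑ =
    subst (0# <_) (sym (det-transpose k (sub B g f))) (B-TP k g f g↑ f↑)

  TPCompletable-transpose : ∀ {m n} {P : Pattern m n} → TPCompletable P → TPCompletable (transpose P)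
  TPCompletable-transpose {P = P} P-compl A A-pTP
    with P-compl (A ᵀ) (PartialTP-transpose {P = transpose P} {A = A} A-pTP)
  ... | B , B≈Aᵀ , B-TP = B ᵀ , (λ i j → B≈Aᵀ j i) , TotallyPositive-transpose {B = B} B-TP

  PartialTP-cong : ∀ {m n} {P : Pattern m n} {A B : Matrix m n} →
                   AgreesOn P A B → PartialTP P A → PartialTP P B
  PartialTP-cong B≈A A-pTP k f g f↑ g↑ spec =
    subst (0# <_) (det-cong k λ a b → sym (B≈A _ _ (spec a b))) (A-pTP k f g f↑ g↑ spec)

  TotallyPositive-deleteRow : ∀ {m n} (r : Fin (suc m)) {B : Matrix (suc m) n} →
    TotallyPositive B → TotallyPositive (λ i j → B (punchIn r i) j)
  TotallyPositive-deleteRow r B-TP k f g f↑ g↑ =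
    B-TP k (punchIn r ∘ f) g (λ a b → punchIn-mono-< r ∘ f↑ a b) g↑

  insertRow : ∀ {m n} → Fin (suc m) → (Fin n → R) → Matrix m n → Matrix (suc m) n
  insertRow r v X i j with i ≟ r
  ... | yes _   = v j
  ... | no  i≢r = X (punchOut (i≢r ∘ sym)) j

  module _ {m n} {r : Fin (suc m)} {v : Fin n → R} {X : Matrix m n} where

    insertRow-at : ∀ j → insertRow r v X r j ≡ v j
    insertRow-at j with r ≟ r
    ... | yes _   = refl
    ... | no  r≢r = contradiction refl r≢r

    insertRow-off : ∀ {i} (r≢i : r ≢ i) j → insertRow r v X i j ≡ X (punchOut r≢i) j
    insertRow-off {i} r≢i j with i ≟ r
    ... | yes i≡r = contradiction (sym i≡r) r≢i
    ... | no  _   = cong (λ a → X a j) (punchOut-cong r refl)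

    insertRow-punchIn : ∀ i j → insertRow r v X (punchIn r i) j ≡ X i j
    insertRow-punchIn i j = trans (insertRow-off (punchInᵢ≢i r i ∘ sym) j)
                                  (cong (λ a → X a j) (punchOut-punchIn r))

    PartialTP-insertRow-avoiding : ∀ {P : Pattern (suc m) n} → PartialTP (deleteRow P r) X →
      ∀ k (f : Fin k → Fin (suc m)) (g : Fin k → Fin n) →
      StrictlyIncreasing f → StrictlyIncreasing g → (∀ a → r ≢ f a) →
      (∀ a b → P (f a) (g b) ≡ true) → 0# < det k (sub (insertRow r v X) f g)
    PartialTP-insertRow-avoiding {P} X-pTP k f g f↑ g↑ r≢f spec =
      subst (0# <_) (det-cong k λ a b → sym (insertRow-off (r≢f a) (g b)))
        (X-pTP k (λ a → punchOut (r≢f a)) g (punchOut-strictlyIncreasing r≢f f↑) g↑ λ a b →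
          subst (λ i → P i (g b) ≡ true) (sym (punchIn-punchOut (r≢f a))) (spec a b))

  clearRow : ∀ {m n} → Fin m → Pattern m n → Pattern m n
  clearRow r P i j = if isRow r i then false else P i j

  module _ {m n} {r : Fin m} {P : Pattern m n} where

    clearRow-specified : ∀ {i j} → clearRow r P i j ≡ true → r ≢ i × P i j ≡ true
    clearRow-specified {i} with i ≟ r
    ... | yes _   = λ ()
    ... | no  i≢r = λ spec → i≢r ∘ sym , spec

    clearRow-∨-isRow-off : ∀ {i j} → r ≢ i → (clearRow r P i j ∨ isRow r i) ≡ true →
                           clearRow r P i j ≡ true
    clearRow-∨-isRow-off {i} r≢i with i ≟ r
    ... | yes i≡r = contradiction (sym i≡r) r≢i
    ... | no  _   = trans (sym (∨-identityʳ _))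

    clearRow-∨-isRow : ∀ {i j} → P i j ≡ true → (clearRow r P i j ∨ isRow r i) ≡ true
    clearRow-∨-isRow {i} with i ≟ r
    ... | yes _ = λ _ → refl
    ... | no  _ = trans (∨-identityʳ _)

  PartialTP-selectColumns : ∀ {m n k} {P : Pattern m n} {A : Matrix m n} → PartialTP P A →
    (c : Fin k → Fin n) → StrictlyIncreasing c →
    PartialTP (λ i l → P i (c l)) (λ i l → A i (c l))
  PartialTP-selectColumns A-pTP c c↑ k f g f↑ g↑ =
    A-pTP k f (c ∘ g) f↑ (λ a b → c↑ (g a) (g b) ∘ g↑ a b)

  PartialTP-insertRow : ∀ {m n} {P : Pattern (suc m) n} {r} (v : Fin n → R) {X : Matrix m n} →
    PartialTP (deleteRow P r) X → PartialTP (clearRow r P) (insertRow r v X)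
  PartialTP-insertRow {P = P} {r} v X-pTP k f g f↑ g↑ spec =
    PartialTP-insertRow-avoiding {v = v} {P = P} X-pTP k f g f↑ g↑
      (λ a → proj₁ (specified (spec a a))) (λ a b → proj₂ (specified (spec a b)))
    where specified = clearRow-specified {r = r} {P}

  extendGoodRow : ∀ {m n} {P : Pattern (suc m) n} {r} → GoodRow P r → ∀ {X : Matrix m n} →
    PartialTP (deleteRow P r) X → Σ (Fin n → R) λ v → PartialTP P (insertRow r v X)
  extendGoodRow {m} {n} {P} {r} good {X} X-pTP = v , A-pTP
    where
    open Enumeration (enumerate (P r))

    Pᵢ Q : Pattern (suc m) size
    Pᵢ i l = P i (index l)
    Q = clearRow r Pᵢ

    -- Row r is unspecified in Q, so the 0# placed there is arbitrary.
    filled : Σ (Matrix (suc m) size) λ B →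
               AgreesOn Q (insertRow r (λ _ → 0#) (λ i l → X i (index l))) B ×
               PartialTP (λ i l → Q i l ∨ isRow r i) B
    filled = proj₂ (good size index increasing sound complete) _
      (PartialTP-insertRow {P = Pᵢ} (λ _ → 0#)
        (PartialTP-selectColumns {P = deleteRow P r} {A = X} X-pTP index increasing))

    B : Matrix (suc m) size
    B = proj₁ filled

    entry : ∀ j b → P r j ≡ b → R
    entry j true  spec = B r (proj₁ (complete j spec))
    entry j false _    = 0#

    v : Fin n → R
    v j = entry j (P r j) refl

    entry-index : ∀ l b (spec : P r (index l) ≡ b) → entry (index l) b spec ≡ B r l
    entry-index l true  spec =
      cong (B r) (StrictlyIncreasing⇒injective increasing (proj₂ (complete (index l) spec)))
    entry-index l false spec = contradiction (trans (sym (sound l)) spec) λ ()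

    agrees-on-row : ∀ l → insertRow r v X r (index l) ≡ B r l
    agrees-on-row l = trans (insertRow-at {r = r} {v} {X} (index l)) (entry-index l (P r (index l)) refl)

    agrees-off-row : ∀ {i} l → r ≢ i → Q i l ≡ true → insertRow r v X i (index l) ≡ B i l
    agrees-off-row {i} l r≢i Q-spec = begin
      insertRow r v X i (index l)                          ≡⟨ insertRow-off r≢i (index l) ⟩
      X (punchOut r≢i) (index l)                           ≡⟨ insertRow-off r≢i l ⟨
      insertRow r (λ _ → 0#) (λ i l → X i (index l)) i l  ≡⟨ proj₁ (proj₂ filled) i l Q-spec ⟨
      B i l                                                ∎

    agrees : AgreesOn (λ i l → Q i l ∨ isRow r i) B (λ i l → insertRow r v X i (index l))
    agrees i l spec with r ≟ i
    ... | yes refl = agrees-on-row l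
    ... | no  r≢i  = agrees-off-row l r≢i (clearRow-∨-isRow-off {P = Pᵢ} r≢i spec)

    A-pTP : PartialTP P (insertRow r v X)
    A-pTP k f g f↑ g↑ spec with any? (λ a → f a ≟ r)
    ... | no avoids = PartialTP-insertRow-avoiding {P = P} X-pTP k f g f↑ g↑
                        (λ a r≡fa → avoids (a , sym r≡fa)) spec
    ... | yes (a , fa≡r) =
      subst (0# <_) (det-cong k λ i j → cong (insertRow r v X (f i)) (index-g′ j))
        (PartialTP-cong agrees (proj₂ (proj₂ filled)) k f g′ f↑ g′↑ λ i j →
          clearRow-∨-isRow {r = r} {Pᵢ}
            (subst (λ c → P (f i) c ≡ true) (sym (index-g′ j)) (spec i j)))
      where
      -- The submatrix meets row r, so all its columns are specified in row r,
      -- i.e. it is a submatrix of the filled-in restriction to those columns.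
      row-specified : ∀ b → P r (g b) ≡ true
      row-specified b = subst (λ i → P i (g b) ≡ true) fa≡r (spec a b)

      g′ : Fin k → Fin size
      g′ b = proj₁ (complete (g b) (row-specified b))

      index-g′ : ∀ b → index (g′ b) ≡ g b
      index-g′ b = proj₂ (complete (g b) (row-specified b))

      g′↑ : StrictlyIncreasing g′
      g′↑ b b′ b<b′ = StrictlyIncreasing⇒cancel-< increasing
        (subst₂ _<ᶠ_ (sym (index-g′ b)) (sym (index-g′ b′)) (g↑ b b′ b<b′))

  TPCompletable-deleteRow : ∀ {m n} {P : Pattern (suc m) n} {r} →
    GoodRow P r → TPCompletable P → TPCompletable (deleteRow P r)
  TPCompletable-deleteRow {P = P} {r} good P-compl X X-pTP with extendGoodRow {P = P} good X-pTP
  ... | v , A-pTP with P-compl (insertRow r v X) A-pTP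
  ...   | B , B≈A , B-TP =
    (λ i j → B (punchIn r i) j) ,
    (λ i j spec → trans (B≈A _ j spec) (insertRow-punchIn {r = r} {v} {X} i j)) ,
    TotallyPositive-deleteRow r {B} B-TP

  TPCompletable-deleteColumn : ∀ {m n} {P : Pattern m (suc n)} {c} →
    GoodColumn P c → TPCompletable P → TPCompletable (deleteColumn P c)
  TPCompletable-deleteColumn {P = P} good P-compl =
    TPCompletable-transpose {P = deleteRow (transpose P) _}
      (TPCompletable-deleteRow {P = transpose P} good (TPCompletable-transpose {P = P} P-compl))

lemma5 : (F : CompleteOrderedField) → ∀ {m n m' n'} →
    (P : Pattern m n) (P' : Pattern m' n') →
    OverField.DeleteGoodLine F P P' →
    ¬ OverField.TPCompletable F P' → ¬ OverField.TPCompletable F P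
lemma5 F P _ (OverField.row    _ _ good) P′-incompletable =
  P′-incompletable ∘ TPCompletable-deleteRow F good
lemma5 F P _ (OverField.column _ _ good) P′-incompletable =
  P′-incompletable ∘ TPCompletable-deleteColumn F good
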